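{- Let $p$ be a prime, $r\ge1$, and $\varepsilon\in\{1,-1\}$. Let $a,b\in\mathbb{Z}/p^r\mathbb{Z}$ with $a,b\equiv0\pmod p$ and $b\ne0$ in $\mathbb{Z}/p^r\mathbb{Z}$, and let $s=\nu_p(a)$, $t=\nu_p(b)$. Then the number of paths in $\mathscr{E}_{p^r}$ of the form \[ \frac{ -\varepsilon+a}{b}\to w\to\frac{\varepsilon}{0} \] (i.e. the number of vertices $w$ for which this is a path) is $0$ if $s<t$, and is $p^t$ if $s\ge t$.
   Context: For a positive integer $n$, $\mathscr{E}_n$ is the directed graph whose vertices are the pairs $(a,b)$ with $a,b\in\{0,\dots,n-1\}$ and $\gcd(a,b,n)=1$, written $a/b$ (integer representatives modulo $n$ may also be used), with a directed edge $a/b\to c/d$ iff $ad-bc\equiv1\pmod n$. For $x\in\mathbb{Z}/p^r\mathbb{Z}$, $\nu_p(x)$ is the $p$-adic valuation of its representative in $\{0,\dots,p^r-1\}$, with $\nu_p(0)=\infty$. -}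

module Defs where

open import Data.Nat as ℕ using (ℕ; suc; _^_; _≟_)
open import Data.Nat.Divisibility using (_∣_; _∣?_)
open import Data.Nat.GCD using (gcd)
open import Data.Integer as ℤ using (ℤ; +_; ∣_∣)
open import Data.Fin using (Fin; toℕ)
open import Data.List using (List; length; filter; allFin; cartesianProduct)
open import Data.Product using (_×_; _,_)
open import Relation.Nullary using (¬_; Dec)
open import Relation.Nullary.Decidable using (_×-dec_)
open import Relation.Binary.PropositionalEquality using (_≡_)

_≡_[mod_] : ℤ → ℤ → ℕ → Set
x ≡ y [mod n ] = n ∣ ∣ (x ℤ.- y) ∣

_≡?_[mod_] : ∀ x y n → Dec (x ≡ y [mod n ])
x ≡? y [mod n ] = n ∣? ∣ (x ℤ.- y) ∣

IsVertex : (n : ℕ) → Fin n × Fin n → Set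
IsVertex n (a , b) = gcd (gcd (toℕ a) (toℕ b)) n ≡ 1

isVertex? : (n : ℕ) → (w : Fin n × Fin n) → Dec (IsVertex n w)
isVertex? n (a , b) = gcd (gcd (toℕ a) (toℕ b)) n ≟ 1

-- Directed edge a/b → c/d in E_n (integer representatives allowed):
-- ad - bc ≡ 1 (mod n).
Edge : (n : ℕ) → ℤ × ℤ → ℤ × ℤ → Set
Edge n (a , b) (c , d) = (a ℤ.* d ℤ.- b ℤ.* c) ≡ ℤ.+ 1 [mod n ]

edge? : (n : ℕ) → ∀ u v → Dec (Edge n u v)
edge? n (a , b) (c , d) = (a ℤ.* d ℤ.- b ℤ.* c) ≡? ℤ.+ 1 [mod n ]

toℤ² : ∀ {n} → Fin n × Fin n → ℤ × ℤ
toℤ² (c , d) = (+ toℕ c , + toℕ d)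

numPaths2 : (n : ℕ) → ℤ × ℤ → ℤ × ℤ → ℕ
numPaths2 n u v =
  length (filter (λ w → isVertex? n w ×-dec (edge? n u (toℤ² w) ×-dec edge? n (toℤ² w) v))
                 (cartesianProduct (allFin n) (allFin n)))

-- ν_p(x) = k  (for x ≠ 0; ν_p(0) = ∞ is handled separately).
Val : (p x k : ℕ) → Set
Val p x k = (p ^ k ∣ x) × ¬ (p ^ suc k ∣ x)

-- Let N = p^r. A middle vertex c/d of such a path has d ≡ -ε (mod N), which pins d down and
-- makes c/d a vertex automatically; the first edge then says exactly b c + ε a ≡ 0 (mod N). So
-- the paths are counted by the solutions c ∈ [0, N) of a linear congruence. Writing
-- N = p^t · p^(r-t) and b = q p^t with p ∤ q, there is no solution unless p^t ∣ a; otherwise the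
-- congruence is q c ≡ -ε a / p^t (mod p^(r-t)), with exactly one solution in each of p^t periods.
module Submission where

open import Defs
open import Level using (Level)
open import Data.Nat as ℕ using (ℕ; zero; suc; _^_; _∸_; _<_; _≤_; _≟_; z<s; s<s; NonZero)
import Data.Nat.Properties as ℕ
open import Data.Nat.Divisibility using (_∣_)
import Data.Nat.Divisibility as ℕ
open import Data.Nat.Coprimality using (Coprime; coprime-Bézout; coprime-factors)
import Data.Nat.Coprimality as Coprime
open import Data.Nat.GCD using (gcd; gcd[m,n]∣m; gcd[m,n]∣n; module Bézout)
open import Data.Nat.Primality using (Prime; prime⇒irreducible; prime⇒nonZero)
open import Data.Fin using (Fin; toℕ)
open import Data.Fin.Properties using (toℕ<n)
open import Data.List using ([]; _∷_; _++_; length; filter; map; allFin; cartesianProduct; tabulate)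
open import Data.List.Properties using (length-++; filter-++; filter-≐; filter-none; map-tabulate)
open import Data.List.Relation.Unary.All using (universal)
open import Data.Integer as ℤ using (ℤ; +_; -_; _+_; _-_; _*_; 0ℤ; 1ℤ)
open import Data.Integer.Properties
  using (+-injective; pos-*; *-comm; *-assoc; *-identityˡ; neg-involutive; neg-distribˡ-*; +-inverseʳ;
         m-n≡m⊖n; ∣m⊝n∣≤m⊔n; ∣i∣≡0⇒i≡0; i-j≡0⇒i≡j)
open import Data.Integer.DivMod using (_%ℕ_; _/ℕ_; n%ℕd<d; a≡a%ℕn+[a/ℕn]*n)
import Data.Integer.Divisibility.Signed as ℤ
import Data.Integer.Coprimality as ℤ
open import Data.Integer.Tactic.RingSolver using (solve-∀)
open import Data.Product using (_×_; _,_; Σ; ∃; proj₁; proj₂)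
open import Data.Sum using (_⊎_; inj₁; inj₂)
open import Function using (_∘_; _⇔_; mk⇔; Equivalence)
open import Function.Related.Propositional using (module EquationalReasoning)
open import Relation.Nullary using (¬_; yes; no; contradiction)
open import Relation.Unary using (Pred; Decidable; _≐_; _⟨×⟩_)
open import Relation.Unary.Properties using (_×?_)
open import Relation.Binary.PropositionalEquality using (_≡_; refl; sym; trans; cong; cong₂; subst; module ≡-Reasoning)

private
  variable
    a b ℓ ℓ₁ ℓ₂ : Level
    A : Set a
    B : Set b

-- Counting

count : {P : Pred ℕ ℓ} → Decidable P → ℕ → ℕ
count P? zero    = 0
count P? (suc n) with P? 0
... | yes _ = suc (count (P? ∘ suc) n)
... | no  _ = count (P? ∘ suc) n

pointwise-⇔⇒≐ : {P : Pred A ℓ₁} {Q : Pred A ℓ₂} → (∀ x → P x ⇔ Q x) → P ≐ Q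
pointwise-⇔⇒≐ P⇔Q = (λ {x} → Equivalence.to (P⇔Q x)) , (λ {x} → Equivalence.from (P⇔Q x))

count-≐ : {P : Pred ℕ ℓ₁} {Q : Pred ℕ ℓ₂} (P? : Decidable P) (Q? : Decidable Q) →
          P ≐ Q → ∀ n → count P? n ≡ count Q? n
count-≐ P? Q? P≐Q zero = refl
count-≐ P? Q? (P⊆Q , Q⊆P) (suc n) with P? 0 | Q? 0
... | yes _  | yes _  = cong suc (count-≐ (P? ∘ suc) (Q? ∘ suc) (P⊆Q , Q⊆P) n)
... | yes p₀ | no ¬q₀ = contradiction (P⊆Q p₀) ¬q₀
... | no ¬p₀ | yes q₀ = contradiction (Q⊆P q₀) ¬p₀
... | no _   | no _   = count-≐ (P? ∘ suc) (Q? ∘ suc) (P⊆Q , Q⊆P) n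

count-+ : {P : Pred ℕ ℓ} (P? : Decidable P) →
          ∀ m n → count P? (m ℕ.+ n) ≡ count P? m ℕ.+ count (P? ∘ (m ℕ.+_)) n
count-+ P? zero    n = refl
count-+ P? (suc m) n with P? 0
... | yes _ = cong suc (count-+ (P? ∘ suc) m n)
... | no  _ = count-+ (P? ∘ suc) m n

count-periodic : {P : Pred ℕ ℓ} (P? : Decidable P) → ∀ m → P ∘ (m ℕ.+_) ≐ P →
                 ∀ k → count P? (k ℕ.* m) ≡ k ℕ.* count P? m
count-periodic P? m per zero    = refl
count-periodic P? m per (suc k) = begin
  count P? (m ℕ.+ k ℕ.* m)                         ≡⟨ count-+ P? m (k ℕ.* m) ⟩
  count P? m ℕ.+ count (P? ∘ (m ℕ.+_)) (k ℕ.* m)   ≡⟨ cong (count P? m ℕ.+_) (count-≐ _ P? per (k ℕ.* m)) ⟩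
  count P? m ℕ.+ count P? (k ℕ.* m)                ≡⟨ cong (count P? m ℕ.+_) (count-periodic P? m per k) ⟩
  count P? m ℕ.+ k ℕ.* count P? m                  ∎
  where open ≡-Reasoning

count-none : {P : Pred ℕ ℓ} (P? : Decidable P) → ∀ n → (∀ {i} → i < n → ¬ P i) → count P? n ≡ 0
count-none P? zero    none = refl
count-none P? (suc n) none with P? 0
... | yes p₀ = contradiction p₀ (none z<s)
... | no  _  = count-none (P? ∘ suc) n (none ∘ s<s)

count-unique : {P : Pred ℕ ℓ} (P? : Decidable P) → ∀ n {c} → c < n → P c →
               (∀ {i} → i < n → P i → i ≡ c) → count P? n ≡ 1
count-unique P? (suc n) {zero} _ p₀ unique with P? 0
... | yes _  = cong suc (count-none (P? ∘ suc) n λ i<n pᵢ → contradiction (unique (s<s i<n) pᵢ) λ ())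
... | no ¬p₀ = contradiction p₀ ¬p₀
count-unique P? (suc n) {suc c} (s<s c<n) pc unique with P? 0
... | yes p₀ = contradiction (unique z<s p₀) λ ()
... | no  _  = count-unique (P? ∘ suc) n c<n pc λ i<n pᵢ → ℕ.suc-injective (unique (s<s i<n) pᵢ)

length-filter-map : {P : Pred B ℓ} (P? : Decidable P) (f : A → B) →
                    ∀ xs → length (filter P? (map f xs)) ≡ length (filter (P? ∘ f) xs)
length-filter-map P? f []       = refl
length-filter-map P? f (x ∷ xs) with P? (f x)
... | yes _ = cong suc (length-filter-map P? f xs)
... | no  _ = length-filter-map P? f xs

length-filter-tabulate : {P : Pred A ℓ} (P? : Decidable P) (f : ℕ → A) →
                         ∀ n → length (filter P? (tabulate {n = n} (f ∘ toℕ))) ≡ count (P? ∘ f) n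
length-filter-tabulate P? f zero    = refl
length-filter-tabulate P? f (suc n) with P? (f 0)
... | yes _ = cong suc (length-filter-tabulate P? (f ∘ suc) n)
... | no  _ = length-filter-tabulate P? (f ∘ suc) n

length-filter-allFin : {P : Pred ℕ ℓ} (P? : Decidable P) →
                       ∀ n → length (filter (P? ∘ toℕ) (allFin n)) ≡ count P? n
length-filter-allFin P? n = begin
  length (filter (P? ∘ toℕ) (allFin n))      ≡⟨ length-filter-map P? toℕ (allFin n) ⟨
  length (filter P? (map toℕ (allFin n)))    ≡⟨ cong (length ∘ filter P?) (map-tabulate {n = n} (λ i → i) toℕ) ⟩
  length (filter P? (tabulate {n = n} toℕ))  ≡⟨ length-filter-tabulate P? (λ i → i) n ⟩
  count P? n                                 ∎
  where open ≡-Reasoning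

length-filter-cartesianProduct-∷ : {R : Pred (A × B) ℓ} (R? : Decidable R) → ∀ x xs ys →
  length (filter R? (cartesianProduct (x ∷ xs) ys))
    ≡ length (filter (R? ∘ (x ,_)) ys) ℕ.+ length (filter R? (cartesianProduct xs ys))
length-filter-cartesianProduct-∷ R? x xs ys = begin
  length (filter R? (map (x ,_) ys ++ cartesianProduct xs ys))
    ≡⟨ cong length (filter-++ R? (map (x ,_) ys) (cartesianProduct xs ys)) ⟩
  length (filter R? (map (x ,_) ys) ++ filter R? (cartesianProduct xs ys))
    ≡⟨ length-++ (filter R? (map (x ,_) ys)) ⟩
  length (filter R? (map (x ,_) ys)) ℕ.+ length (filter R? (cartesianProduct xs ys))
    ≡⟨ cong (ℕ._+ _) (length-filter-map R? (x ,_) ys) ⟩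
  length (filter (R? ∘ (x ,_)) ys) ℕ.+ length (filter R? (cartesianProduct xs ys)) ∎
  where open ≡-Reasoning

length-filter-cartesianProduct : {P : Pred A ℓ₁} {Q : Pred B ℓ₂} (P? : Decidable P) (Q? : Decidable Q) →
  ∀ xs ys → length (filter (P? ×? Q?) (cartesianProduct xs ys)) ≡ length (filter P? xs) ℕ.* length (filter Q? ys)
length-filter-cartesianProduct P? Q? []       ys = refl
length-filter-cartesianProduct P? Q? (x ∷ xs) ys
  rewrite length-filter-cartesianProduct-∷ (P? ×? Q?) x xs ys
        | length-filter-cartesianProduct P? Q? xs ys
  with P? x
... | yes p = cong (ℕ._+ _) (cong length (filter-≐ _ Q? (proj₂ , (p ,_)) ys))
... | no ¬p = cong (ℕ._+ _) (cong length (filter-none _ (universal (λ _ → ¬p ∘ proj₁) ys)))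

length-filter-allFin²-fixed-snd : ∀ {n d₀} → d₀ < n →
  {R : Pred (Fin n × Fin n) ℓ₁} (R? : Decidable R) {Q : Pred ℕ ℓ₂} (Q? : Decidable Q) →
  R ≐ ((Q ∘ toℕ) ⟨×⟩ ((_≡ d₀) ∘ toℕ)) →
  length (filter R? (cartesianProduct (allFin n) (allFin n))) ≡ count Q? n
length-filter-allFin²-fixed-snd {n = n} {d₀} d₀<n R? Q? R≐Q×d₀ = begin
  length (filter R? (cartesianProduct (allFin n) (allFin n)))
    ≡⟨ cong length (filter-≐ R? (Q? ∘ toℕ ×? (_≟ d₀) ∘ toℕ) R≐Q×d₀ (cartesianProduct (allFin n) (allFin n))) ⟩
  length (filter (Q? ∘ toℕ ×? (_≟ d₀) ∘ toℕ) (cartesianProduct (allFin n) (allFin n)))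
    ≡⟨ length-filter-cartesianProduct (Q? ∘ toℕ) ((_≟ d₀) ∘ toℕ) (allFin n) (allFin n) ⟩
  length (filter (Q? ∘ toℕ) (allFin n)) ℕ.* length (filter ((_≟ d₀) ∘ toℕ) (allFin n))
    ≡⟨ cong₂ ℕ._*_ (length-filter-allFin Q? n) (length-filter-allFin (_≟ d₀) n) ⟩
  count Q? n ℕ.* count (_≟ d₀) n
    ≡⟨ cong (count Q? n ℕ.*_) (count-unique (_≟ d₀) n d₀<n refl (λ _ i≡d₀ → i≡d₀)) ⟩
  count Q? n ℕ.* 1
    ≡⟨ ℕ.*-identityʳ (count Q? n) ⟩
  count Q? n ∎
  where open ≡-Reasoning

-- Integer divisibility

∣m+n⇔∣m : ∀ {i m n} → i ℤ.∣ n → (i ℤ.∣ m + n) ⇔ (i ℤ.∣ m)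
∣m+n⇔∣m i∣n = mk⇔ (λ i∣m+n → ℤ.∣m+n∣n⇒∣m i∣m+n i∣n) (λ i∣m → ℤ.∣m∣n⇒∣m+n i∣m i∣n)

∣-m⇔∣m : ∀ {i m} → (i ℤ.∣ - m) ⇔ (i ℤ.∣ m)
∣-m⇔∣m {m = m} = mk⇔ (λ i∣-m → subst (_ ℤ.∣_) (neg-involutive m) (ℤ.∣m⇒∣-m i∣-m)) ℤ.∣m⇒∣-m

∣ε*m⇔∣m : ∀ {i m} ε → ε * ε ≡ 1ℤ → (i ℤ.∣ ε * m) ⇔ (i ℤ.∣ m)
∣ε*m⇔∣m {i} {m} ε ε²≡1 = mk⇔ cancel (ℤ.∣n⇒∣m*n ε)
  where
  ε*[ε*m]≡m : ε * (ε * m) ≡ m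
  ε*[ε*m]≡m = trans (sym (*-assoc ε ε m)) (trans (cong (_* m) ε²≡1) (*-identityˡ m))
  cancel : i ℤ.∣ ε * m → i ℤ.∣ m
  cancel i∣εm = subst (i ℤ.∣_) ε*[ε*m]≡m (ℤ.∣n⇒∣m*n ε i∣εm)

m∣n-o⇔n≡o : ∀ {m n o} → n < m → o < m → (+ m ℤ.∣ + n - + o) ⇔ (n ≡ o)
m∣n-o⇔n≡o {m} {n} {o} n<m o<m =
  mk⇔ m∣n-o⇒n≡o λ { refl → subst (+ m ℤ.∣_) (sym (+-inverseʳ (+ n))) (ℤ.divides 0ℤ refl) }
  where
  ∣n-o∣<m : ℤ.∣ + n - + o ∣ < m
  ∣n-o∣<m = subst (_< m) (cong ℤ.∣_∣ (sym (m-n≡m⊖n n o)))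
                  (ℕ.≤-<-trans (∣m⊝n∣≤m⊔n n o) (ℕ.⊔-lub n<m o<m))
  multiple-below-≡0 : ∀ {k} → k < m → m ∣ k → k ≡ 0
  multiple-below-≡0 {zero}  _   _   = refl
  multiple-below-≡0 {suc k} k<m m∣k = contradiction (ℕ.∣⇒≤ m∣k) (ℕ.<⇒≱ k<m)
  m∣n-o⇒n≡o : + m ℤ.∣ + n - + o → n ≡ o
  m∣n-o⇒n≡o m∣n-o =
    +-injective (i-j≡0⇒i≡j (+ n) (+ o) (∣i∣≡0⇒i≡0 (multiple-below-≡0 ∣n-o∣<m (ℤ.∣⇒∣ᵤ m∣n-o))))

n∣x%ℕn-x : ∀ x n .{{_ : NonZero n}} → + n ℤ.∣ + (x %ℕ n) - x
n∣x%ℕn-x x n = ℤ.divides (- (x /ℕ n)) (begin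
  + (x %ℕ n) - x                            ≡⟨ cong (_-_ (+ (x %ℕ n))) (a≡a%ℕn+[a/ℕn]*n x n) ⟩
  + (x %ℕ n) - (+ (x %ℕ n) + x /ℕ n * + n)  ≡⟨ r-[r+q*n]≡-q*n (+ (x %ℕ n)) (x /ℕ n) (+ n) ⟩
  - (x /ℕ n) * + n                          ∎)
  where
  open ≡-Reasoning
  r-[r+q*n]≡-q*n : ∀ r q n → r - (r + q * n) ≡ - q * n
  r-[r+q*n]≡-q*n = solve-∀

Edge⇔∣ : ∀ n x y z w → Edge n (x , y) (z , w) ⇔ (+ n ℤ.∣ x * w - y * z - 1ℤ)
Edge⇔∣ n x y z w = mk⇔ ℤ.∣ᵤ⇒∣ ℤ.∣⇒∣ᵤ

-- Two-step paths ending at ε/0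

module _ (n : ℕ) .{{_ : NonZero n}} {ε : ℤ} (ε²≡1 : ε * ε ≡ 1ℤ) where

  open EquationalReasoning

  private
    d₀ : ℕ
    d₀ = (- ε) %ℕ n

    d₀<n : d₀ < n
    d₀<n = n%ℕd<d (- ε) n

    n∣d₀+ε : + n ℤ.∣ + d₀ + ε
    n∣d₀+ε = subst (+ n ℤ.∣_) (cong (_+_ (+ d₀)) (neg-involutive ε)) (n∣x%ℕn-x (- ε) n)

  Edge-to-ε/0⇔ : ∀ c {d} → d < n → Edge n (+ c , + d) (ε , + 0) ⇔ (d ≡ d₀)
  Edge-to-ε/0⇔ c {d} d<n = begin
    Edge n (+ c , + d) (ε , + 0)             ∼⟨ Edge⇔∣ n (+ c) (+ d) ε (+ 0) ⟩
    + n ℤ.∣ + c * + 0 - + d * ε - 1ℤ          ≡⟨ cong (λ k → + n ℤ.∣ + c * + 0 - + d * ε - k) (sym ε²≡1) ⟩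
    + n ℤ.∣ + c * + 0 - + d * ε - ε * ε       ≡⟨ cong (+ n ℤ.∣_) (factor-ε (+ c) (+ d) ε (+ d₀)) ⟩
    + n ℤ.∣ ε * - ((+ d - + d₀) + (+ d₀ + ε)) ∼⟨ ∣ε*m⇔∣m ε ε²≡1 ⟩
    + n ℤ.∣ - ((+ d - + d₀) + (+ d₀ + ε))     ∼⟨ ∣-m⇔∣m ⟩
    + n ℤ.∣ (+ d - + d₀) + (+ d₀ + ε)         ∼⟨ ∣m+n⇔∣m n∣d₀+ε ⟩
    + n ℤ.∣ + d - + d₀                        ∼⟨ m∣n-o⇔n≡o d<n d₀<n ⟩
    d ≡ d₀                                    ∎
    where
    factor-ε : ∀ c d ε d₀ → c * 0ℤ - d * ε - ε * ε ≡ ε * - ((d - d₀) + (d₀ + ε))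
    factor-ε = solve-∀

  d₀-isVertex : ∀ c → gcd (gcd c d₀) n ≡ 1
  d₀-isVertex c = ℕ.∣1⇒≡1 (ℤ.∣⇒∣ᵤ g∣1)
    where
    g : ℕ
    g = gcd (gcd c d₀) n
    g∣d₀ : + g ℤ.∣ + d₀
    g∣d₀ = ℤ.∣ᵤ⇒∣ (ℕ.∣-trans (gcd[m,n]∣m (gcd c d₀) n) (gcd[m,n]∣n c d₀))
    g∣ε : + g ℤ.∣ ε
    g∣ε = ℤ.∣m+n∣m⇒∣n (ℤ.∣-trans (ℤ.∣ᵤ⇒∣ (gcd[m,n]∣n (gcd c d₀) n)) n∣d₀+ε) g∣d₀
    g∣1 : + g ℤ.∣ 1ℤ
    g∣1 = subst (+ g ℤ.∣_) ε²≡1 (ℤ.∣m⇒∣m*n ε g∣ε)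

  Edge-from-start⇔ : ∀ a b c → Edge n (- ε + + a , + b) (+ c , + d₀) ⇔ (+ n ℤ.∣ + b * + c + ε * + a)
  Edge-from-start⇔ a b c = begin
    Edge n (- ε + + a , + b) (+ c , + d₀)                    ∼⟨ Edge⇔∣ n (- ε + + a) (+ b) (+ c) (+ d₀) ⟩
    + n ℤ.∣ (- ε + + a) * + d₀ - + b * + c - 1ℤ              ≡⟨ cong (λ k → + n ℤ.∣ (- ε + + a) * + d₀ - + b * + c - k) (sym ε²≡1) ⟩
    + n ℤ.∣ (- ε + + a) * + d₀ - + b * + c - ε * ε           ≡⟨ cong (+ n ℤ.∣_) (regroup ε (+ a) (+ b) (+ c) (+ d₀)) ⟩
    + n ℤ.∣ - (+ b * + c + ε * + a) + (+ a - ε) * (+ d₀ + ε) ∼⟨ ∣m+n⇔∣m (ℤ.∣n⇒∣m*n (+ a - ε) n∣d₀+ε) ⟩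
    + n ℤ.∣ - (+ b * + c + ε * + a)                          ∼⟨ ∣-m⇔∣m ⟩
    + n ℤ.∣ + b * + c + ε * + a                              ∎
    where
    regroup : ∀ ε a b c d₀ → (- ε + a) * d₀ - b * c - ε * ε ≡ - (b * c + ε * a) + (a - ε) * (d₀ + ε)
    regroup = solve-∀

  numPaths2≡count : ∀ a b → numPaths2 n (- ε + + a , + b) (ε , + 0)
                            ≡ count (λ c → + n ℤ.∣? + b * + c + ε * + a) n
  numPaths2≡count a b = length-filter-allFin²-fixed-snd d₀<n _ _ (path⇒ , ⇒path)
    where
    start : ℤ × ℤ
    start = (- ε + + a , + b)
    IsPath : Fin n × Fin n → Set
    IsPath w = IsVertex n w × Edge n start (toℤ² w) × Edge n (toℤ² w) (ε , + 0)
    Solution : Fin n × Fin n → Set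
    Solution (c , d) = (+ n ℤ.∣ + b * + toℕ c + ε * + a) × toℕ d ≡ d₀
    path⇒ : ∀ {w} → IsPath w → Solution w
    path⇒ {c , d} (_ , e₁ , e₂) =
      Equivalence.to (Edge-from-start⇔ a b (toℕ c)) (subst (λ d → Edge n start (+ toℕ c , + d)) d≡d₀ e₁) , d≡d₀
      where
      d≡d₀ : toℕ d ≡ d₀
      d≡d₀ = Equivalence.to (Edge-to-ε/0⇔ (toℕ c) (toℕ<n d)) e₂
    ⇒path : ∀ {w} → Solution w → IsPath w
    ⇒path {c , d} (sol , d≡d₀) =
        subst (λ d → gcd (gcd (toℕ c) d) n ≡ 1) (sym d≡d₀) (d₀-isVertex (toℕ c))
      , subst (λ d → Edge n start (+ toℕ c , + d)) (sym d≡d₀) (Equivalence.from (Edge-from-start⇔ a b (toℕ c)) sol)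
      , Equivalence.from (Edge-to-ε/0⇔ (toℕ c) (toℕ<n d)) d≡d₀

-- Linear congruences

pos-1+*≡* : ∀ a b c d → 1 ℕ.+ a ℕ.* b ≡ c ℕ.* d → 1ℤ + + a * + b ≡ + c * + d
pos-1+*≡* a b c d eq = begin
  1ℤ + + a * + b      ≡⟨ cong (_+_ 1ℤ) (pos-* a b) ⟨
  + (1 ℕ.+ a ℕ.* b)   ≡⟨ cong +_ eq ⟩
  + (c ℕ.* d)         ≡⟨ pos-* c d ⟩
  + c * + d           ∎
  where open ≡-Reasoning

inverse-mod : ∀ {m u} → Coprime m u → ∃ λ v → + m ℤ.∣ + u * v - 1ℤ
inverse-mod {m} {u} m⊥u with coprime-Bézout (Coprime.sym m⊥u)
... | Bézout.+- x y eq = + x , ℤ.divides (+ y) (begin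
  + u * + x - 1ℤ         ≡⟨ cong (_- 1ℤ) (*-comm (+ u) (+ x)) ⟩
  + x * + u - 1ℤ         ≡⟨ cong (_- 1ℤ) (pos-1+*≡* y m x u eq) ⟨
  1ℤ + + y * + m - 1ℤ    ≡⟨ 1+k-1≡k (+ y * + m) ⟩
  + y * + m              ∎)
  where
  open ≡-Reasoning
  1+k-1≡k : ∀ k → 1ℤ + k - 1ℤ ≡ k
  1+k-1≡k = solve-∀
... | Bézout.-+ x y eq = - + x , ℤ.divides (- + y) (begin
  + u * - + x - 1ℤ       ≡⟨ u*-x-1≡-[1+x*u] (+ u) (+ x) ⟩
  - (1ℤ + + x * + u)     ≡⟨ cong -_ (pos-1+*≡* x u y m eq) ⟩
  - (+ y * + m)          ≡⟨ neg-distribˡ-* (+ y) (+ m) ⟩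
  - + y * + m            ∎)
  where
  open ≡-Reasoning
  u*-x-1≡-[1+x*u] : ∀ u x → u * - x - 1ℤ ≡ - (1ℤ + x * u)
  u*-x-1≡-[1+x*u] = solve-∀

module _ {m u : ℕ} .{{_ : NonZero m}} (m⊥u : Coprime m u) (e : ℤ) where

  solution-unique : ∀ {c c′} → c < m → c′ < m →
                    + m ℤ.∣ + u * + c + e → + m ℤ.∣ + u * + c′ + e → c ≡ c′
  solution-unique {c} {c′} c<m c′<m m∣c m∣c′ = Equivalence.to (m∣n-o⇔n≡o c<m c′<m) (ℤ.∣ᵤ⇒∣ m∣c-c′)
    where
    difference : ∀ u c c′ e → (u * c + e) - (u * c′ + e) ≡ u * (c - c′)
    difference = solve-∀
    m∣u*[c-c′] : + m ℤ.∣ + u * (+ c - + c′)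
    m∣u*[c-c′] = subst (+ m ℤ.∣_) (difference (+ u) (+ c) (+ c′) e) (ℤ.∣m∣n⇒∣m-n m∣c m∣c′)
    m∣c-c′ : m ∣ ℤ.∣ + c - + c′ ∣
    m∣c-c′ = ℤ.coprime-divisor (+ m) (+ u) (+ c - + c′) m⊥u (ℤ.∣⇒∣ᵤ m∣u*[c-c′])

  solution-exists : ∃ λ c → c < m × + m ℤ.∣ + u * + c + e
  solution-exists = c₀ , n%ℕd<d (- (e * v)) m , subst (+ m ℤ.∣_) (sym (regroup (+ u) (+ c₀) e v)) m∣u*c₀+e
    where
    v : ℤ
    v = proj₁ (inverse-mod m⊥u)
    m∣uv-1 : + m ℤ.∣ + u * v - 1ℤ
    m∣uv-1 = proj₂ (inverse-mod m⊥u)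
    c₀ : ℕ
    c₀ = (- (e * v)) %ℕ m
    regroup : ∀ u c e v → u * c + e ≡ u * (c - - (e * v)) + - e * (u * v - 1ℤ)
    regroup = solve-∀
    m∣u*c₀+e : + m ℤ.∣ + u * (+ c₀ - - (e * v)) + - e * (+ u * v - 1ℤ)
    m∣u*c₀+e = ℤ.∣m∣n⇒∣m+n (ℤ.∣n⇒∣m*n (+ u) (n∣x%ℕn-x (- (e * v)) m)) (ℤ.∣n⇒∣m*n (- e) m∣uv-1)

  count-solutions-period : count (λ c → + m ℤ.∣? + u * + c + e) m ≡ 1
  count-solutions-period =
    let c₀ , c₀<m , m∣c₀ = solution-exists
    in  count-unique _ m c₀<m m∣c₀ (λ c<m m∣c → solution-unique c<m c₀<m m∣c m∣c₀)

  solutions-periodic : ∀ c → (+ m ℤ.∣ + u * + (m ℕ.+ c) + e) ⇔ (+ m ℤ.∣ + u * + c + e)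
  solutions-periodic c = begin
    + m ℤ.∣ + u * + (m ℕ.+ c) + e         ≡⟨ cong (+ m ℤ.∣_) (shift (+ u) (+ m) (+ c) e) ⟩
    + m ℤ.∣ (+ u * + c + e) + + u * + m   ∼⟨ ∣m+n⇔∣m (ℤ.∣n⇒∣m*n (+ u) ℤ.∣-refl) ⟩
    + m ℤ.∣ + u * + c + e                 ∎
    where
    open EquationalReasoning
    shift : ∀ u m c e → u * (m + c) + e ≡ (u * c + e) + u * m
    shift = solve-∀

  count-solutions : ∀ k → count (λ c → + m ℤ.∣? + u * + c + e) (k ℕ.* m) ≡ k
  count-solutions k = begin
    count (λ c → + m ℤ.∣? + u * + c + e) (k ℕ.* m)   ≡⟨ count-periodic _ m (pointwise-⇔⇒≐ solutions-periodic) k ⟩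
    k ℕ.* count (λ c → + m ℤ.∣? + u * + c + e) m     ≡⟨ cong (k ℕ.*_) count-solutions-period ⟩
    k ℕ.* 1                                          ≡⟨ ℕ.*-identityʳ k ⟩
    k                                                ∎
    where open ≡-Reasoning

count-scaled-solutions-∣ : ∀ {P m u e} .{{_ : NonZero P}} .{{_ : NonZero m}} → Coprime m u → + P ℤ.∣ e →
  count (λ c → + (P ℕ.* m) ℤ.∣? + (u ℕ.* P) * + c + e) (P ℕ.* m) ≡ P
count-scaled-solutions-∣ {P} {m} {u} m⊥u (ℤ.divides e′ refl) =
  trans (count-≐ _ _ (pointwise-⇔⇒≐ cancel-P) (P ℕ.* m)) (count-solutions m⊥u e′ P)
  where
  cancel-P : ∀ c → (+ (P ℕ.* m) ℤ.∣ + (u ℕ.* P) * + c + e′ * + P) ⇔ (+ m ℤ.∣ + u * + c + e′)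
  cancel-P c = begin
    + (P ℕ.* m) ℤ.∣ + (u ℕ.* P) * + c + e′ * + P  ≡⟨ cong₂ ℤ._∣_ (pos-* P m) (cong (λ k → k * + c + e′ * + P) (pos-* u P)) ⟩
    + P * + m ℤ.∣ + u * + P * + c + e′ * + P      ≡⟨ cong (+ P * + m ℤ.∣_) (factor-P (+ P) (+ u) (+ c) e′) ⟩
    + P * + m ℤ.∣ + P * (+ u * + c + e′)          ∼⟨ mk⇔ (ℤ.*-cancelˡ-∣ (+ P)) (ℤ.*-monoʳ-∣ (+ P)) ⟩
    + m ℤ.∣ + u * + c + e′                        ∎
    where
    open EquationalReasoning
    factor-P : ∀ P u c e → u * P * c + e * P ≡ P * (u * c + e)
    factor-P = solve-∀

count-scaled-solutions-∤ : ∀ {P m u e} → ¬ (+ P ℤ.∣ e) →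
  count (λ c → + (P ℕ.* m) ℤ.∣? + (u ℕ.* P) * + c + e) (P ℕ.* m) ≡ 0
count-scaled-solutions-∤ {P} {m} {u} {e} P∤e = count-none _ (P ℕ.* m) (λ _ → P∤e ∘ P∣e)
  where
  P∣e : ∀ {c} → + (P ℕ.* m) ℤ.∣ + (u ℕ.* P) * + c + e → + P ℤ.∣ e
  P∣e {c} Pm∣ = ℤ.∣m+n∣m⇒∣n (ℤ.∣-trans (ℤ.∣ᵤ⇒∣ (ℕ.m∣m*n m)) Pm∣)
                             (ℤ.∣m⇒∣m*n {m = + (u ℕ.* P)} (+ c) (ℤ.∣ᵤ⇒∣ (ℕ.n∣m*n u)))

-- Prime-power moduli

^-split : ∀ p {m n} → m ≤ n → p ^ n ≡ p ^ m ℕ.* p ^ (n ∸ m)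
^-split p {m} {n} m≤n = trans (cong (p ^_) (sym (ℕ.m+[n∸m]≡n m≤n))) (ℕ.^-distribˡ-+-* p m (n ∸ m))

^-monoʳ-∣ : ∀ p {m n} → m ≤ n → p ^ m ∣ p ^ n
^-monoʳ-∣ p {m} m≤n = subst (p ^ m ∣_) (sym (^-split p m≤n)) (ℕ.m∣m*n _)

coprime-^ : ∀ {p q} → Prime p → ¬ p ∣ q → ∀ k → Coprime (p ^ k) q
coprime-^ p-prime p∤q zero    (d∣1 , _) = ℕ.∣1⇒≡1 d∣1
coprime-^ {p} {q} p-prime p∤q (suc k) (d∣pᵏ⁺¹ , d∣q) =
  coprime-^ p-prime p∤q k (coprime-factors p⊥q (d∣pᵏ⁺¹ , ℕ.∣m⇒∣m*n (p ^ k) d∣q) , d∣q)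
  where
  p⊥q : Coprime p q
  p⊥q (d∣p , d∣q) with prime⇒irreducible p-prime d∣p
  ... | inj₁ d≡1  = d≡1
  ... | inj₂ refl = contradiction d∣q p∤q

module PrimePowerModulus {p q r t : ℕ} (p-prime : Prime p) (p∤q : ¬ p ∣ q) (b<pʳ : q ℕ.* p ^ t < p ^ r)
                         {ε : ℤ} (ε²≡1 : ε * ε ≡ 1ℤ) (a : ℕ) where

  private
    instance
      p≢0 : NonZero p
      p≢0 = prime⇒nonZero p-prime
      pᵗ≢0 : NonZero (p ^ t)
      pᵗ≢0 = ℕ.m^n≢0 p t
      pʳ⁻ᵗ≢0 : NonZero (p ^ (r ∸ t))
      pʳ⁻ᵗ≢0 = ℕ.m^n≢0 p (r ∸ t)
      pʳ≢0 : NonZero (p ^ r)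
      pʳ≢0 = ℕ.m^n≢0 p r

    t≤r : t ≤ r
    t≤r = ℕ.≮⇒≥ λ r<t →
      ℕ.<⇒≱ (ℕ.≤-<-trans (ℕ.m≤n*m (p ^ t) q {{q≢0}}) b<pʳ) (ℕ.^-monoʳ-≤ p (ℕ.<⇒≤ r<t))
      where
      q≢0 : NonZero q
      q≢0 = ℕ.≢-nonZero λ { refl → p∤q (p ℕ.∣0) }

    numPaths2≡count-scaled : numPaths2 (p ^ r) (- ε + + a , + (q ℕ.* p ^ t)) (ε , + 0)
      ≡ count (λ c → + (p ^ t ℕ.* p ^ (r ∸ t)) ℤ.∣? + (q ℕ.* p ^ t) * + c + ε * + a) (p ^ t ℕ.* p ^ (r ∸ t))
    numPaths2≡count-scaled = trans (numPaths2≡count (p ^ r) ε²≡1 a (q ℕ.* p ^ t))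
      (cong (λ N → count (λ c → + N ℤ.∣? + (q ℕ.* p ^ t) * + c + ε * + a) N) (^-split p t≤r))

  numPaths2-pᵗ∣a : p ^ t ∣ a → numPaths2 (p ^ r) (- ε + + a , + (q ℕ.* p ^ t)) (ε , + 0) ≡ p ^ t
  numPaths2-pᵗ∣a pᵗ∣a = trans numPaths2≡count-scaled
    (count-scaled-solutions-∣ (coprime-^ p-prime p∤q (r ∸ t))
                              (Equivalence.from (∣ε*m⇔∣m ε ε²≡1) (ℤ.∣ᵤ⇒∣ pᵗ∣a)))

  numPaths2-pᵗ∤a : ¬ p ^ t ∣ a → numPaths2 (p ^ r) (- ε + + a , + (q ℕ.* p ^ t)) (ε , + 0) ≡ 0
  numPaths2-pᵗ∤a pᵗ∤a = trans numPaths2≡count-scaled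
    (count-scaled-solutions-∤ {u = q} {e = ε * + a}
                              (pᵗ∤a ∘ ℤ.∣⇒∣ᵤ ∘ Equivalence.to (∣ε*m⇔∣m ε ε²≡1)))

±1²≡1 : ∀ {ε} → ε ≡ 1ℤ ⊎ ε ≡ - 1ℤ → ε * ε ≡ 1ℤ
±1²≡1 (inj₁ refl) = refl
±1²≡1 (inj₂ refl) = refl

lemma7 : (p r : ℕ) → Prime p → 1 ≤ r → (ε : ℤ) → (ε ≡ ℤ.+ 1 ⊎ ε ≡ ℤ.- ℤ.+ 1) →
    (a b : ℕ) → a < p ^ r → b < p ^ r → p ∣ a → p ∣ b → ¬ (b ≡ 0) →
    (t : ℕ) → Val p b t →
      ((s : ℕ) → Val p a s → s < t → numPaths2 (p ^ r) (ℤ.- ε ℤ.+ + a , + b) (ε , + 0) ≡ 0)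
      × ((a ≡ 0 ⊎ (Σ ℕ λ s → Val p a s × t ≤ s)) → numPaths2 (p ^ r) (ℤ.- ε ℤ.+ + a , + b) (ε , + 0) ≡ p ^ t)
lemma7 p r p-prime _ ε ε≡±1 a b _ b<pʳ _ _ _ t (ℕ.divides q refl , pᵗ⁺¹∤b) =
    (λ s (_ , pˢ⁺¹∤a) s<t → numPaths2-pᵗ∤a (pˢ⁺¹∤a ∘ ℕ.∣-trans (^-monoʳ-∣ p s<t)))
  , numPaths2-pᵗ∣a ∘ pᵗ∣a
  where
  p∤q : ¬ p ∣ q
  p∤q = pᵗ⁺¹∤b ∘ ℕ.*-monoˡ-∣ (p ^ t)
  open PrimePowerModulus {r = r} {t} p-prime p∤q b<pʳ {ε} (±1²≡1 ε≡±1) a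
  pᵗ∣a : (a ≡ 0 ⊎ Σ ℕ λ s → Val p a s × t ≤ s) → p ^ t ∣ a
  pᵗ∣a (inj₁ refl)                   = (p ^ t) ℕ.∣0
  pᵗ∣a (inj₂ (s , (pˢ∣a , _) , t≤s)) = ℕ.∣-trans (^-monoʳ-∣ p t≤s) pˢ∣a
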